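{- Let $P=e_1\ldots e_k$ be a path in $G$ (given as a sequence of arcs). Then each of the families of open real intervals $\{(i,\bar{s}(i)) : 1\le i\le k\}$ and $\{(\underline{s}(i),i) : 1\le i\le k\}$ is laminar, i.e., any two intervals in the same family are either disjoint or one contains the other.
   Context: $G=(V,A,g)$ is a directed graph with real arc gains. For a path $Q=u_1\ldots u_m$ let $g_{u_i}=\sum_{t=1}^{i-1}g(u_tu_{t+1})$ ($g_{u_1}=0$). $Q$ is $u_1u_2$-bounded (first-arc-bounded) if either $g(u_1u_2)\ge0$ and $0\le g_{u_i}\le g(u_1u_2)$ for all $i$, or $g(u_1u_2)\le0$ and $g(u_1u_2)\le g_{u_i}\le0$ for all $i$. $Q$ is $u_{m-1}u_m$-bounded (last-arc-bounded) if either $g(u_{m-1}u_m)\ge0$ and $g_{u_{m-1}}\le g_{u_i}\le g_{u_m}$ for all $i$, or $g(u_{m-1}u_m)<0$ and $g_{u_m}\le g_{u_i}\le g_{u_{m-1}}$ for all $i$. For $1\le i\le k$, $\bar{s}(i)\ge i$ is the maximal index such that $e_i\ldots e_{\bar{s}(i)}$ is $e_i$-bounded (first-arc-bounded with bounding arc $e_i$), and $\underline{s}(i)\le i$ is the smallest index such that $e_{\underline{s}(i)}\ldots e_i$ is $e_i$-bounded (last-arc-bounded with bounding arc $e_i$). -}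

module Defs where

open import Level using (0ℓ)
open import Data.Nat as ℕ using (ℕ; zero; suc; _∸_; _<?_)
open import Data.Fin using (Fin; toℕ; fromℕ<)
open import Data.Product using (_×_)
open import Data.Sum using (_⊎_)
open import Data.Empty using (⊥)
open import Relation.Nullary using (¬_; yes; no)
open import Relation.Binary using (Rel)
open import Relation.Binary.Structures using (IsTotalOrder)
open import Relation.Binary.PropositionalEquality using (_≡_; _≢_)
open import Algebra.Core using (Op₁; Op₂)
open import Algebra.Structures using (IsAbelianGroup)
open import Function.Definitions using (Injective)
open import Data.Integer using (+_)
open import Data.Rational as ℚ using (ℚ; _/_)

-- Gains take values in a totally ordered abelian group (ℝ being the
-- paper's instance; reals are unavailable in agda-stdlib).
record OrderedAbelianGroup : Set₁ where
  infixl 6 _+_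
  infix 4 _≤_ _<_
  field
    Carrier        : Set
    _+_            : Op₂ Carrier
    0#             : Carrier
    -_             : Op₁ Carrier
    _≤_            : Rel Carrier 0ℓ
    isAbelianGroup : IsAbelianGroup _≡_ _+_ 0# -_
    isTotalOrder   : IsTotalOrder _≡_ _≤_
    +-monoʳ-≤      : ∀ {x y} z → x ≤ y → z + x ≤ z + y

  _<_ : Rel Carrier 0ℓ
  x < y = x ≤ y × x ≢ y

record GainGraph (O : OrderedAbelianGroup) : Set₁ where
  open OrderedAbelianGroup O
  field
    V    : Set
    A    : Set
    tail : A → V
    head : A → V
    gain : A → Carrier

-- Open real intervals with natural endpoints, viewed as sets of rationals
-- (membership of rationals determines such intervals).
Interval : ℕ → ℕ → ℚ → Set
Interval a b x = (+ a / 1) ℚ.< x × x ℚ.< (+ b / 1)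

Disjoint : (ℚ → Set) → (ℚ → Set) → Set
Disjoint I J = ∀ x → I x → J x → ⊥

_⊆_ : (ℚ → Set) → (ℚ → Set) → Set
I ⊆ J = ∀ x → I x → J x

LaminarPair : (ℚ → Set) → (ℚ → Set) → Set
LaminarPair I J = Disjoint I J ⊎ (I ⊆ J ⊎ J ⊆ I)

module PathDefs (O : OrderedAbelianGroup) (G : GainGraph O)
                (k : ℕ) (e : Fin k → GainGraph.A G) where
  open OrderedAbelianGroup O
  open GainGraph G

  IsPath : Set
  IsPath =
    (∀ (t t' : Fin k) → suc (toℕ t) ≡ toℕ t' → head (e t) ≡ tail (e t'))
    × Injective _≡_ _≡_ (λ t → tail (e t))
    × (∀ (t t' : Fin k) → suc (toℕ t) ≡ k → head (e t) ≢ tail (e t'))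

  -- gain of the arc e_t (1-based index; 0# outside 1..k, never used there)
  gAt : ℕ → Carrier
  gAt zero = 0#
  gAt (suc t) with t <? k
  ... | yes p = gain (e (fromℕ< p))
  ... | no _  = 0#

  psum : ℕ → ℕ → Carrier
  psum i zero    = 0#
  psum i (suc n) = psum i n + gAt (i ℕ.+ n)

  -- For a subpath starting with arc e_i (tail vertex u), S i t is the gain
  -- g_v of the vertex v = tail e_t (= head e_{t-1}), for t ≥ i.
  S : ℕ → ℕ → Carrier
  S i t = psum i (t ∸ i)

  -- e_i … e_j is e_i-bounded (first-arc-bounded); vertices correspond to
  -- t = i, …, j+1.
  FirstArcBounded : ℕ → ℕ → Set
  FirstArcBounded i j =
    (0# ≤ gAt i × (∀ t → i ℕ.≤ t → t ℕ.≤ suc j → 0# ≤ S i t × S i t ≤ gAt i))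
    ⊎ (gAt i ≤ 0# × (∀ t → i ℕ.≤ t → t ℕ.≤ suc j → gAt i ≤ S i t × S i t ≤ 0#))

  -- e_h … e_i is e_i-bounded (last-arc-bounded); vertices t = h, …, i+1,
  -- u_{m-1} ↔ t = i, u_m ↔ t = i+1.
  LastArcBounded : ℕ → ℕ → Set
  LastArcBounded h i =
    (0# ≤ gAt i × (∀ t → h ℕ.≤ t → t ℕ.≤ suc i → S h i ≤ S h t × S h t ≤ S h (suc i)))
    ⊎ (gAt i < 0# × (∀ t → h ℕ.≤ t → t ℕ.≤ suc i → S h (suc i) ≤ S h t × S h t ≤ S h i))

  IsSbar : ℕ → ℕ → Set
  IsSbar i j = 1 ℕ.≤ i × i ℕ.≤ k × i ℕ.≤ j × j ℕ.≤ k × FirstArcBounded i j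
               × (∀ j' → i ℕ.≤ j' → j' ℕ.≤ k → FirstArcBounded i j' → j' ℕ.≤ j)

  IsSunder : ℕ → ℕ → Set
  IsSunder i h = 1 ℕ.≤ i × i ℕ.≤ k × 1 ℕ.≤ h × h ℕ.≤ i × LastArcBounded h i
                 × (∀ h' → 1 ℕ.≤ h' → h' ℕ.≤ i → LastArcBounded h' i → h ℕ.≤ h')

  SbarLaminar : Set
  SbarLaminar = ∀ i j i' j' → IsSbar i j → IsSbar i' j' →
                LaminarPair (Interval i j) (Interval i' j')

  SunderLaminar : Set
  SunderLaminar = ∀ i h i' h' → IsSunder i h → IsSunder i' h' →
                  LaminarPair (Interval h i) (Interval h' i')

{-# OPTIONS --safe #-}
module Submission where

-- If e_i … e_j is e_i-bounded and i ≤ i' < j, then along any e_i'-bounded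
-- path e_i' … e_j' the gains stay between the gains at the two ends of e_i',
-- and these already lie between 0 and g(e_i).  Hence e_i … e_j' is still
-- e_i-bounded, and maximality of s̄(i) gives s̄(i') ≤ s̄(i): two intervals of
-- the family are disjoint or nested.  The last-arc-bounded case is the mirror
-- image, with minimality of s̲ in place of maximality of s̄.

open import Defs
open import Data.Nat as ℕ using (ℕ; suc; s≤s; _≤?_)
open import Data.Nat.Properties
  using (≤-trans; ≤-total; <⇒≤; ≰⇒>; m≤n⇒m≤1+n; m≤n⇒∃[o]m+o≡n; m+n∸m≡n; +-identityʳ; +-assoc; +-suc)
open import Data.Fin using (Fin)
open import Data.Integer using (+_; +≤+)
open import Data.Integer.Properties using (*-monoʳ-≤-nonNeg)
open import Data.Rational as ℚ using (mkℚ; _/_; *≤*)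
open import Data.Rational.Properties using (normalize-coprime; <-≤-trans; ≤-<-trans; <-asym)
open import Data.Nat.Coprimality using (1-coprimeTo) renaming (sym to coprime-sym)
open import Data.Product using (_×_; _,_; map₂)
open import Data.Sum as Sum using (inj₁; inj₂)
open import Relation.Nullary using (yes; no)
open import Relation.Binary.PropositionalEquality
  using (_≡_; refl; sym; cong; cong₂; subst; module ≡-Reasoning)
open import Algebra.Structures using (IsAbelianGroup)
open import Relation.Binary.Structures using (IsTotalOrder)

/1≡mkℚ : ∀ m → + m / 1 ≡ mkℚ (+ m) 0 (coprime-sym (1-coprimeTo m))
/1≡mkℚ m = normalize-coprime (coprime-sym (1-coprimeTo m))

/1-mono-≤ : ∀ {m n} → m ℕ.≤ n → + m / 1 ℚ.≤ + n / 1
/1-mono-≤ {m} {n} m≤n rewrite /1≡mkℚ m | /1≡mkℚ n = *≤* (*-monoʳ-≤-nonNeg (+ 1) (+≤+ m≤n))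

Disjoint-sym : ∀ {I J} → Disjoint I J → Disjoint J I
Disjoint-sym I∩J=∅ x x∈J x∈I = I∩J=∅ x x∈I x∈J

LaminarPair-sym : ∀ {I J} → LaminarPair I J → LaminarPair J I
LaminarPair-sym (inj₁ I∩J=∅)    = inj₁ (Disjoint-sym I∩J=∅)
LaminarPair-sym (inj₂ (inj₁ I⊆J)) = inj₂ (inj₂ I⊆J)
LaminarPair-sym (inj₂ (inj₂ J⊆I)) = inj₂ (inj₁ J⊆I)

Interval-disjoint : ∀ {a b a' b'} → b ℕ.≤ a' → Disjoint (Interval a b) (Interval a' b')
Interval-disjoint b≤a' x (_ , x<b) (a'<x , _) = <-asym (<-≤-trans x<b (/1-mono-≤ b≤a')) a'<x

Interval-⊆ : ∀ {a b a' b'} → a ℕ.≤ a' → b' ℕ.≤ b → Interval a' b' ⊆ Interval a b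
Interval-⊆ a≤a' b'≤b x (a'<x , x<b') =
  ≤-<-trans (/1-mono-≤ a≤a') a'<x , <-≤-trans x<b' (/1-mono-≤ b'≤b)

Interval-laminarˡ : ∀ {a b a' b'} → a ℕ.≤ a' → (a' ℕ.< b → b' ℕ.≤ b) →
                    LaminarPair (Interval a b) (Interval a' b')
Interval-laminarˡ {a} {b} {a'} {b'} a≤a' nested with b ≤? a'
... | yes b≤a' = inj₁ (Interval-disjoint {a} {b} {a'} {b'} b≤a')
... | no  b≰a' = inj₂ (inj₂ (Interval-⊆ {a} {b} {a'} {b'} a≤a' (nested (≰⇒> b≰a'))))

Interval-laminarʳ : ∀ {a b a' b'} → b' ℕ.≤ b → (a ℕ.< b' → a ℕ.≤ a') →
                    LaminarPair (Interval a b) (Interval a' b')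
Interval-laminarʳ {a} {b} {a'} {b'} b'≤b nested with b' ≤? a
... | yes b'≤a = inj₁ (Disjoint-sym (Interval-disjoint {a'} {b'} {a} {b} b'≤a))
... | no  b'≰a = inj₂ (inj₂ (Interval-⊆ {a} {b} {a'} {b'} (nested (≰⇒> b'≰a)) b'≤b))

module OrderedAbelianGroupProperties (O : OrderedAbelianGroup) where
  open OrderedAbelianGroup O
  open IsTotalOrder isTotalOrder using () renaming (trans to ≤-trans′)

  Between : Carrier → Carrier → Carrier → Set
  Between x y z = x ≤ z × z ≤ y

  Between↕ : Carrier → Carrier → Carrier → Set
  Between↕ x y z = Between x y z Sum.⊎ Between y x z

  Between-convex : ∀ {A B x y z} → Between A B x → Between A B y → Between↕ x y z → Between A B z
  Between-convex (A≤x , _) (_ , y≤B) (inj₁ (x≤z , z≤y)) = ≤-trans′ A≤x x≤z , ≤-trans′ z≤y y≤B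
  Between-convex (_ , x≤B) (A≤y , _) (inj₂ (y≤z , z≤x)) = ≤-trans′ A≤y y≤z , ≤-trans′ z≤x x≤B

  Between-+ˡ : ∀ {x y z} c → Between x y z → Between (c + x) (c + y) (c + z)
  Between-+ˡ c (x≤z , z≤y) = +-monoʳ-≤ c x≤z , +-monoʳ-≤ c z≤y

  Between↕-+ˡ : ∀ {x y z} c → Between↕ x y z → Between↕ (c + x) (c + y) (c + z)
  Between↕-+ˡ c = Sum.map (Between-+ˡ c) (Between-+ˡ c)

  module _ (f : ℕ → Carrier) where

    BoundedOn : Carrier → Carrier → ℕ → ℕ → Set
    BoundedOn A B lo hi = ∀ t → lo ℕ.≤ t → t ℕ.≤ hi → Between A B (f t)

    StepBoundedOn : ℕ → ℕ → ℕ → Set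
    StepBoundedOn m lo hi = ∀ t → lo ℕ.≤ t → t ℕ.≤ hi → Between↕ (f m) (f (suc m)) (f t)

  module _ {f : ℕ → Carrier} {A B : Carrier} where

    BoundedOn-absorb : ∀ {lo hi m lo' hi'} → BoundedOn f A B lo hi → lo ℕ.≤ m → m ℕ.< hi →
                       StepBoundedOn f m lo' hi' → BoundedOn f A B lo' hi'
    BoundedOn-absorb H lo≤m m<hi step t lo'≤t t≤hi' =
      Between-convex (H _ lo≤m (<⇒≤ m<hi)) (H _ (m≤n⇒m≤1+n lo≤m) m<hi) (step t lo'≤t t≤hi')

    BoundedOn-join : ∀ {lo hi lo' hi'} → lo' ℕ.≤ hi → BoundedOn f A B lo hi →
                     BoundedOn f A B lo' hi' → BoundedOn f A B lo hi'
    BoundedOn-join {hi = hi} lo'≤hi H H' t lo≤t t≤hi' with t ≤? hi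
    ... | yes t≤hi = H t lo≤t t≤hi
    ... | no  t≰hi = H' t (≤-trans lo'≤hi (<⇒≤ (≰⇒> t≰hi))) t≤hi'

module PathProperties (O : OrderedAbelianGroup) (G : GainGraph O)
                      (k : ℕ) (e : Fin k → GainGraph.A G) where
  open OrderedAbelianGroup O
  open OrderedAbelianGroupProperties O
  open PathDefs O G k e
  open IsAbelianGroup isAbelianGroup using (assoc; identityʳ)
  open ≡-Reasoning

  psum-+ : ∀ i a b → psum i (a ℕ.+ b) ≡ psum i a + psum (i ℕ.+ a) b
  psum-+ i a ℕ.zero  rewrite +-identityʳ a = sym (identityʳ _)
  psum-+ i a (suc b) rewrite +-suc a b | psum-+ i a b | +-assoc i a b = assoc _ _ _

  S-+ : ∀ i a → S i (i ℕ.+ a) ≡ psum i a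
  S-+ i a = cong (psum i) (m+n∸m≡n i a)

  S-split : ∀ {i m t} → i ℕ.≤ m → m ℕ.≤ t → S i t ≡ S i m + S m t
  S-split {i} i≤m m≤t with a , refl ← m≤n⇒∃[o]m+o≡n i≤m | b , refl ← m≤n⇒∃[o]m+o≡n m≤t = begin
    S i (i ℕ.+ a ℕ.+ b)          ≡⟨ cong (S i) (+-assoc i a b) ⟩
    S i (i ℕ.+ (a ℕ.+ b))        ≡⟨ S-+ i (a ℕ.+ b) ⟩
    psum i (a ℕ.+ b)             ≡⟨ psum-+ i a b ⟩
    psum i a + psum (i ℕ.+ a) b  ≡⟨ sym (cong₂ _+_ (S-+ i a) (S-+ (i ℕ.+ a) b)) ⟩
    S i (i ℕ.+ a) + S (i ℕ.+ a) (i ℕ.+ a ℕ.+ b) ∎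

  S-suc : ∀ {h i} → h ℕ.≤ i → S h (suc i) ≡ S h i + gAt i
  S-suc {h} h≤i with a , refl ← m≤n⇒∃[o]m+o≡n h≤i = begin
    S h (suc (h ℕ.+ a))        ≡⟨ cong (S h) (sym (+-suc h a)) ⟩
    S h (h ℕ.+ suc a)          ≡⟨ S-+ h (suc a) ⟩
    psum h a + gAt (h ℕ.+ a)   ≡⟨ cong (_+ gAt (h ℕ.+ a)) (sym (S-+ h a)) ⟩
    S h (h ℕ.+ a) + gAt (h ℕ.+ a) ∎

  BoundedOn-rebase : ∀ {h' h a b hi} → h' ℕ.≤ h → h ℕ.≤ a → h ℕ.≤ b →
                     BoundedOn (S h) (S h a) (S h b) h hi →
                     BoundedOn (S h') (S h' a) (S h' b) h hi
  BoundedOn-rebase {h'} {h} h'≤h h≤a h≤b H t h≤t t≤hi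
    rewrite S-split h'≤h h≤a | S-split h'≤h h≤b | S-split h'≤h h≤t =
    Between-+ˡ (S h' h) (H t h≤t t≤hi)

  FirstArcBounded⇒StepBoundedOn : ∀ {h i j} → h ℕ.≤ i → FirstArcBounded i j →
                                  StepBoundedOn (S h) i i (suc j)
  FirstArcBounded⇒StepBoundedOn {h} {i} {j} h≤i F t i≤t t≤1+j
    rewrite S-suc h≤i | S-split h≤i i≤t =
    subst (λ x → Between↕ x (S h i + gAt i) (S h i + S i t)) (identityʳ (S h i))
          (Between↕-+ˡ (S h i) (arcBounds F))
    where
    arcBounds : FirstArcBounded i j → Between↕ 0# (gAt i) (S i t)
    arcBounds (inj₁ (_ , H)) = inj₁ (H t i≤t t≤1+j)
    arcBounds (inj₂ (_ , H)) = inj₂ (H t i≤t t≤1+j)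

  LastArcBounded⇒StepBoundedOn : ∀ {h i} → LastArcBounded h i → StepBoundedOn (S h) i h (suc i)
  LastArcBounded⇒StepBoundedOn (inj₁ (_ , H)) t h≤t t≤1+i = inj₁ (H t h≤t t≤1+i)
  LastArcBounded⇒StepBoundedOn (inj₂ (_ , H)) t h≤t t≤1+i = inj₂ (H t h≤t t≤1+i)

  FirstArcBounded-absorb : ∀ {i i' j j'} → i ℕ.≤ i' → i' ℕ.≤ j → FirstArcBounded i' j' →
                           FirstArcBounded i j → FirstArcBounded i j'
  FirstArcBounded-absorb {i} {i'} {j} {j'} i≤i' i'≤j F' = Sum.map (map₂ extend) (map₂ extend)
    where
    extend : ∀ {A B} → BoundedOn (S i) A B i (suc j) → BoundedOn (S i) A B i (suc j')
    extend H = BoundedOn-join (m≤n⇒m≤1+n i'≤j) H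
      (BoundedOn-absorb H i≤i' (s≤s i'≤j) (FirstArcBounded⇒StepBoundedOn i≤i' F'))

  LastArcBounded-absorb : ∀ {h h' i i'} → h' ℕ.≤ h → h ℕ.≤ i' → i' ℕ.≤ i →
                          LastArcBounded h' i' → LastArcBounded h i → LastArcBounded h' i
  LastArcBounded-absorb {h} {h'} {i} {i'} h'≤h h≤i' i'≤i L' =
    Sum.map (map₂ (extend h≤i h≤1+i)) (map₂ (extend h≤1+i h≤i))
    where
    h≤i   = ≤-trans h≤i' i'≤i
    h≤1+i = m≤n⇒m≤1+n h≤i
    extend : ∀ {a b} → h ℕ.≤ a → h ℕ.≤ b → BoundedOn (S h) (S h a) (S h b) h (suc i) →
             BoundedOn (S h') (S h' a) (S h' b) h' (suc i)
    extend h≤a h≤b H = BoundedOn-join (m≤n⇒m≤1+n h≤i')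
      (BoundedOn-absorb H' h≤i' (s≤s i'≤i) (LastArcBounded⇒StepBoundedOn L')) H'
      where H' = BoundedOn-rebase h'≤h h≤a h≤b H

  IsSbar-nested : ∀ {i j i' j'} → i ℕ.≤ i' → i' ℕ.< j → IsSbar i j → IsSbar i' j' → j' ℕ.≤ j
  IsSbar-nested i≤i' i'<j (_ , _ , _ , _ , F , maximal) (_ , _ , i'≤j' , j'≤k , F' , _) =
    maximal _ (≤-trans i≤i' i'≤j') j'≤k (FirstArcBounded-absorb i≤i' (<⇒≤ i'<j) F' F)

  IsSunder-nested : ∀ {i h i' h'} → i' ℕ.≤ i → h ℕ.< i' → IsSunder i h → IsSunder i' h' → h ℕ.≤ h'
  IsSunder-nested {h = h} {h' = h'} i'≤i h<i'
    (_ , _ , _ , _ , L , minimal) (_ , _ , 1≤h' , h'≤i' , L' , _) with ≤-total h h'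
  ... | inj₁ h≤h' = h≤h'
  ... | inj₂ h'≤h =
    minimal h' 1≤h' (≤-trans h'≤i' i'≤i) (LastArcBounded-absorb h'≤h (<⇒≤ h<i') i'≤i L' L)

  sbarLaminar : SbarLaminar
  sbarLaminar i j i' j' s s' with ≤-total i i'
  ... | inj₁ i≤i' = Interval-laminarˡ i≤i' (λ i'<j → IsSbar-nested i≤i' i'<j s s')
  ... | inj₂ i'≤i =
    LaminarPair-sym (Interval-laminarˡ i'≤i (λ i<j' → IsSbar-nested i'≤i i<j' s' s))

  sunderLaminar : SunderLaminar
  sunderLaminar i h i' h' s s' with ≤-total i' i
  ... | inj₁ i'≤i = Interval-laminarʳ i'≤i (λ h<i' → IsSunder-nested i'≤i h<i' s s')
  ... | inj₂ i≤i' =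
    LaminarPair-sym (Interval-laminarʳ i≤i' (λ h'<i → IsSunder-nested i≤i' h'<i s' s))

-- Laminarity only involves the gains along the arc sequence.
mainTheorem10 : (O : OrderedAbelianGroup) (G : GainGraph O) (k : ℕ)
                (e : Fin k → GainGraph.A G) →
                PathDefs.IsPath O G k e →
                PathDefs.SbarLaminar O G k e × PathDefs.SunderLaminar O G k e
mainTheorem10 O G k e _ = sbarLaminar , sunderLaminar
  where open PathProperties O G k e
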